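{- Let $F_m$ be the Fibonacci numbers ($F_0=0$, $F_1=1$, $F_m=F_{m-1}+F_{m-2}$ for all integers $m$, so $F_{ -1}=1$), and let $d_{ -1}=1$, $d_0=1$ and for $n\ge1$, $d_{2n-1}=F_{2n-1}/F_{2n-3}$, $d_{2n}=1/d_{2n-1}$. Define formal power series $R_m$ for $m\ge-1$ by \[ R_{ -1}=\frac32-\frac12\sqrt{\frac{1-5x}{1-x}},\qquad R_{2n+1}=d_{2n+1}+\frac{1-3x-\sqrt{(1-x)(1-5x)}}{2x}\ (n\ge0),\qquad R_{2n}=\frac{d_{2n}}{1-xR_{2n+1}}\ (n\ge0). \] Then for all $m\geq -1$, \[ R_m=\frac{d_m}{1-xR_{m+1}}. \]
   Context: Square roots denote the formal power series with constant term $1$; note that $\frac{1-3x-\sqrt{(1-x)(1-5x)}}{2x}$ is a formal power series in $x$. -}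

module Defs where

open import Data.Bool using (Bool; true; false; if_then_else_)
open import Data.Nat as ℕ using (ℕ; zero; suc; _∸_; ⌊_/2⌋; _≤?_)
open import Data.Integer as ℤ using (ℤ; +_; -[1+_])
open import Data.Rational as ℚ using (ℚ; 0ℚ; 1ℚ; _+_; _*_; _-_; -_; _÷_; ≢-nonZero)
open import Data.Rational.Properties using (_≟_)
open import Relation.Nullary using (yes; no)

-- Fibonacci numbers on all integers: F_0 = 0, F_1 = 1,
-- F_m = F_{m-1} + F_{m-2};  for negative indices F_{-n} = (-1)^{n+1} F_n
-- (the unique extension of the recurrence to ℤ; e.g. F_{-1} = 1).

fib : ℕ → ℕ
fib zero = zero
fib (suc zero) = suc zero
fib (suc (suc n)) = fib (suc n) ℕ.+ fib n

fibℤ : ℤ → ℤ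
fibℤ (+ n) = + fib n
fibℤ -[1+ n ] = sign n ℤ.* (+ fib (suc n))
  where
  sign : ℕ → ℤ
  sign zero = + 1
  sign (suc k) = ℤ.- sign k

ι : ℤ → ℚ
ι z = z ℚ./ 1

-- total division on ℚ (p / 0 = 0); only ever used with nonzero denominators
_÷′_ : ℚ → ℚ → ℚ
p ÷′ q with q ≟ 0ℚ
... | yes _ = 0ℚ
... | no q≢0 = _÷_ p q {{≢-nonZero q≢0}}

-- dodd n = d_{2n+1} = F_{2n+1} / F_{2n-1}
dodd : ℕ → ℚ
dodd n = ι (fibℤ (+ (2 ℕ.* n ℕ.+ 1))) ÷′ ι (fibℤ ((+ (2 ℕ.* n ℕ.+ 1)) ℤ.- + 2))

-- deven n = d_{2n}
deven : ℕ → ℚ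
deven zero = 1ℚ
deven (suc n) = 1ℚ ÷′ dodd n

isEven : ℕ → Bool
isEven zero = true
isEven (suc n) = if isEven n then false else true

-- d on integers; only indices m ≥ -1 are meaningful (junk value 0 below -1)
d : ℤ → ℚ
d -[1+ zero ] = 1ℚ
d -[1+ suc _ ] = 0ℚ
d (+ k) = if isEven k then deven ⌊ k /2⌋ else dodd ⌊ k /2⌋

FPS : Set
FPS = ℕ → ℚ

_≈_ : FPS → FPS → Set
f ≈ g = ∀ n → f n ≡ g n
  where open import Relation.Binary.PropositionalEquality using (_≡_)

const : ℚ → FPS
const c zero = c
const c (suc _) = 0ℚ

X : FPS
X (suc zero) = 1ℚ
X _ = 0ℚ

infixl 6 _⊕_ _⊖_
infixl 7 _⊛_

_⊕_ : FPS → FPS → FPS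
(f ⊕ g) n = f n + g n

_⊖_ : FPS → FPS → FPS
(f ⊖ g) n = f n - g n

sumBelow : ℕ → (ℕ → ℚ) → ℚ
sumBelow zero h = 0ℚ
sumBelow (suc n) h = sumBelow n h + h n

_⊛_ : FPS → FPS → FPS
(f ⊛ g) n = sumBelow (suc n) (λ i → f i * g (n ∸ i))

-- course-of-values recursion: coefficient 0 is c0, and coefficient n+1 is
-- step n h, where h gives the already computed coefficients 0..n.
cov : ℚ → (ℕ → (ℕ → ℚ) → ℚ) → ℕ → (ℕ → ℚ)
cov c0 step zero = λ _ → c0
cov c0 step (suc n) k with k ≤? n
... | yes _ = cov c0 step n k
... | no _ = step n (cov c0 step n)

seqFrom : ℚ → (ℕ → (ℕ → ℚ) → ℚ) → FPS
seqFrom c0 step n = cov c0 step n n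

-- multiplicative inverse of a series with invertible constant term:
-- g_0 = 1/f_0,  g_{n+1} = -(1/f_0) Σ_{i=1}^{n+1} f_i g_{n+1-i}
inv : FPS → FPS
inv f = seqFrom (1ℚ ÷′ f 0)
  (λ n h → - ((1ℚ ÷′ f 0) * sumBelow (suc n) (λ j → f (suc j) * h (n ∸ j))))

-- square root with constant term 1 of a series with constant term 1:
-- s_0 = 1,  s_{n+1} = (f_{n+1} - Σ_{i=1}^{n} s_i s_{n+1-i}) / 2
sqrt : FPS → FPS
sqrt f = seqFrom 1ℚ
  (λ n h → (f (suc n) - sumBelow n (λ j → h (suc j) * h (n ∸ j))) ÷′ ι (+ 2))

-- division by x of a series whose constant term vanishes
divX : FPS → FPS
divX f n = f (suc n)

_⊘_ : FPS → FPS → FPS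
f ⊘ g = f ⊛ inv g

q : ℚ → FPS
q c = const c

C : FPS
C = divX ((const 1ℚ ⊖ q (ι (+ 3)) ⊛ X ⊖ sqrt ((const 1ℚ ⊖ X) ⊛ (const 1ℚ ⊖ q (ι (+ 5)) ⊛ X)))
          ⊛ q (1ℚ ÷′ ι (+ 2)))

Rm1 : FPS
Rm1 = q (ι (+ 3) ÷′ ι (+ 2)) ⊖ q (1ℚ ÷′ ι (+ 2)) ⊛ sqrt ((const 1ℚ ⊖ q (ι (+ 5)) ⊛ X) ⊘ (const 1ℚ ⊖ X))

Rodd : ℕ → FPS
Rodd n = q (dodd n) ⊕ C

Reven : ℕ → FPS
Reven n = q (deven n) ⊘ (const 1ℚ ⊖ X ⊛ Rodd n)

-- R on integers; only m ≥ -1 meaningful (junk value 0 below -1)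
R : ℤ → FPS
R -[1+ zero ] = Rm1
R -[1+ suc _ ] = const 0ℚ
R (+ k) = if isEven k then Reven ⌊ k /2⌋ else Rodd ⌊ k /2⌋

-- Power series over ℚ form a commutative ring in which every series with nonzero
-- constant term is a unit and the square root with constant term 1 is unique.
-- With S = √((1−x)(1−5x)) we have 2xC = 1 − 3x − S, hence xC² − (1−3x)C + x = 0.
-- Writing E = 1 − xR_{m+2}, the claim R_m = d_m / (1 − x d_{m+1}/E) becomes, after
-- multiplying by the unit E, the polynomial identity (E − x d_{m+1}) R_m = d_m E.
-- For m = 2n+1 it follows from the quadratic equation of C together with
-- d_{2n+1} d_{2n+2} = 1 and d_{2n+3} + d_{2n+2} = 3, the latter being the Fibonacci
-- identity F_{2n+3} + F_{2n−1} = 3 F_{2n+1}.  For m = −1 it follows from (1−x)T = S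
-- and ST = 1 − 5x, where T = √((1−5x)/(1−x)).  For even m ≥ 0 it is the definition.

module Submission where

open import Defs
open import Data.Bool using (true; false; if_then_else_)
open import Data.Empty using (⊥-elim)
open import Data.Integer as ℤ using (ℤ; _≤_; _+_; -[1+_]; +_; -≤-)
open import Data.Maybe using (Maybe; just; nothing)
open import Data.Nat as ℕ using (ℕ; zero; suc; _∸_; _<_; z≤n; _≤?_; ⌊_/2⌋)
import Data.Nat.Properties as ℕ
import Data.Nat.Coprimality as Coprimality
import Data.Integer.Properties as ℤ
open import Data.Product using (_,_)
open import Data.Rational as ℚ using (ℚ; 0ℚ; 1ℚ; _*_; _-_; -_)
import Data.Rational.Properties as ℚ
open import Relation.Binary.PropositionalEquality
open import Relation.Nullary using (yes; no)
open import Data.Rational.Solver using (module +-*-Solver)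
open import Algebra.Bundles using (CommutativeRing; CommutativeMonoid)
open import Algebra.Structures using (IsCommutativeRing)
open import Algebra.Solver.Ring.AlmostCommutativeRing
  using (fromCommutativeRing; _-Raw-AlmostCommutative⟶_)
import Algebra.Solver.Ring
import Data.Nat.Solver
import Algebra.Properties.Ring
import Relation.Binary.Reasoning.Setoid
open import Algebra.Properties.CommutativeSemigroup
  (CommutativeMonoid.commutativeSemigroup ℚ.+-0-commutativeMonoid) using (interchange)

-- Finite sums and the Cauchy product

sumBelow-cong : ∀ n {f g : ℕ → ℚ} → (∀ i → i < n → f i ≡ g i) →
                sumBelow n f ≡ sumBelow n g
sumBelow-cong zero    f≡g = refl
sumBelow-cong (suc n) f≡g =
  cong₂ ℚ._+_ (sumBelow-cong n (λ i i<n → f≡g i (ℕ.m<n⇒m<1+n i<n))) (f≡g n ℕ.≤-refl)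

sumBelow-distrib-+ : ∀ n (f g : ℕ → ℚ) →
                     sumBelow n (λ i → f i ℚ.+ g i) ≡ sumBelow n f ℚ.+ sumBelow n g
sumBelow-distrib-+ zero    f g = refl
sumBelow-distrib-+ (suc n) f g =
  trans (cong (ℚ._+ (f n ℚ.+ g n)) (sumBelow-distrib-+ n f g))
        (interchange (sumBelow n f) (sumBelow n g) (f n) (g n))

sumBelow-*ˡ : ∀ n c (f : ℕ → ℚ) → sumBelow n (λ i → c * f i) ≡ c * sumBelow n f
sumBelow-*ˡ zero    c f = sym (ℚ.*-zeroʳ c)
sumBelow-*ˡ (suc n) c f =
  trans (cong (ℚ._+ c * f n) (sumBelow-*ˡ n c f)) (sym (ℚ.*-distribˡ-+ c (sumBelow n f) (f n)))

sumBelow-zero : ∀ n (f : ℕ → ℚ) → (∀ i → f i ≡ 0ℚ) → sumBelow n f ≡ 0ℚ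
sumBelow-zero zero    f f≡0 = refl
sumBelow-zero (suc n) f f≡0 = cong₂ ℚ._+_ (sumBelow-zero n f f≡0) (f≡0 n)

sumBelow-suc-head : ∀ n (f : ℕ → ℚ) → sumBelow (suc n) f ≡ f 0 ℚ.+ sumBelow n (λ i → f (suc i))
sumBelow-suc-head zero    f = trans (ℚ.+-identityˡ (f 0)) (sym (ℚ.+-identityʳ (f 0)))
sumBelow-suc-head (suc n) f =
  trans (cong (ℚ._+ f (suc n)) (sumBelow-suc-head n f)) (ℚ.+-assoc (f 0) _ _)

⊛-head : ∀ f g → (f ⊛ g) 0 ≡ f 0 * g 0
⊛-head f g = ℚ.+-identityˡ _

⊛-suc : ∀ f g n → (f ⊛ g) (suc n) ≡ f 0 * g (suc n) ℚ.+ (divX f ⊛ g) n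
⊛-suc f g n = sumBelow-suc-head (suc n) (λ i → f i * g (suc n ∸ i))

⊛-sucʳ : ∀ f g n → (f ⊛ g) (suc n) ≡ (f ⊛ divX g) n ℚ.+ f (suc n) * g 0
⊛-sucʳ f g n = cong₂ ℚ._+_
  (sumBelow-cong (suc n) (λ i i<1+n → cong (λ k → f i * g k) (ℕ.+-∸-assoc 1 (ℕ.<⇒≤pred i<1+n))))
  (cong (λ k → f (suc n) * g k) (ℕ.n∸n≡0 n))

⊛-cong : ∀ {f f′ g g′} → f ≈ f′ → g ≈ g′ → (f ⊛ g) ≈ (f′ ⊛ g′)
⊛-cong f≈f′ g≈g′ n =
  sumBelow-cong (suc n) (λ i _ → cong₂ _*_ (f≈f′ i) (g≈g′ (n ∸ i)))

⊛-comm : ∀ f g → (f ⊛ g) ≈ (g ⊛ f)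
⊛-comm f g zero    = cong (0ℚ ℚ.+_) (ℚ.*-comm (f 0) (g 0))
⊛-comm f g (suc n) = begin
  (f ⊛ g) (suc n)                         ≡⟨ ⊛-suc f g n ⟩
  f 0 * g (suc n) ℚ.+ (divX f ⊛ g) n      ≡⟨ cong₂ ℚ._+_ (ℚ.*-comm (f 0) _) (⊛-comm (divX f) g n) ⟩
  g (suc n) * f 0 ℚ.+ (g ⊛ divX f) n      ≡⟨ ℚ.+-comm (g (suc n) * f 0) _ ⟩
  (g ⊛ divX f) n ℚ.+ g (suc n) * f 0      ≡⟨ ⊛-sucʳ g f n ⟨
  (g ⊛ f) (suc n)                         ∎
  where open ≡-Reasoning

⊛-distribʳ-⊕ : ∀ f g h → ((f ⊕ g) ⊛ h) ≈ (f ⊛ h ⊕ g ⊛ h)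
⊛-distribʳ-⊕ f g h n =
  trans (sumBelow-cong (suc n) (λ i _ → ℚ.*-distribʳ-+ (h (n ∸ i)) (f i) (g i)))
        (sumBelow-distrib-+ (suc n) (λ i → f i * h (n ∸ i)) (λ i → g i * h (n ∸ i)))

⊛-zeroˡ : ∀ f g → (∀ i → f i ≡ 0ℚ) → ∀ n → (f ⊛ g) n ≡ 0ℚ
⊛-zeroˡ f g f≡0 n =
  sumBelow-zero (suc n) _ (λ i → trans (cong (_* g (n ∸ i)) (f≡0 i)) (ℚ.*-zeroˡ (g (n ∸ i))))

const-⊛ˡ : ∀ c g n → (const c ⊛ g) n ≡ c * g n
const-⊛ˡ c g zero    = ⊛-head (const c) g
const-⊛ˡ c g (suc n) =
  trans (⊛-suc (const c) g n)
        (trans (cong (c * g (suc n) ℚ.+_) (⊛-zeroˡ (divX (const c)) g (λ _ → refl) n))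
               (ℚ.+-identityʳ _))

⊛-assoc : ∀ f g h → ((f ⊛ g) ⊛ h) ≈ (f ⊛ (g ⊛ h))
⊛-assoc f g h zero = begin
  ((f ⊛ g) ⊛ h) 0      ≡⟨ ⊛-head (f ⊛ g) h ⟩
  (f ⊛ g) 0 * h 0      ≡⟨ cong (_* h 0) (⊛-head f g) ⟩
  f 0 * g 0 * h 0      ≡⟨ ℚ.*-assoc (f 0) (g 0) (h 0) ⟩
  f 0 * (g 0 * h 0)    ≡⟨ cong (f 0 *_) (⊛-head g h) ⟨
  f 0 * (g ⊛ h) 0      ≡⟨ ⊛-head f (g ⊛ h) ⟨
  (f ⊛ (g ⊛ h)) 0      ∎
  where open ≡-Reasoning
⊛-assoc f g h (suc n) = begin
  ((f ⊛ g) ⊛ h) (suc n)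
    ≡⟨ ⊛-suc (f ⊛ g) h n ⟩
  (f ⊛ g) 0 * h (suc n) ℚ.+ (divX (f ⊛ g) ⊛ h) n
    ≡⟨ cong₂ ℚ._+_ (cong (_* h (suc n)) (⊛-head f g))
                  (⊛-cong {g = h} (⊛-suc f g) (λ _ → refl) n) ⟩
  f 0 * g 0 * h (suc n) ℚ.+ ((f0·g′ ⊕ divX f ⊛ g) ⊛ h) n
    ≡⟨ cong (f 0 * g 0 * h (suc n) ℚ.+_)
            (trans (⊛-distribʳ-⊕ f0·g′ (divX f ⊛ g) h n)
                   (cong₂ ℚ._+_ (scaled-⊛ n) (⊛-assoc (divX f) g h n))) ⟩
  f 0 * g 0 * h (suc n) ℚ.+ (f 0 * (divX g ⊛ h) n ℚ.+ (divX f ⊛ (g ⊛ h)) n)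
    ≡⟨ regroup (f 0) (g 0) (h (suc n)) ((divX g ⊛ h) n) ((divX f ⊛ (g ⊛ h)) n) ⟩
  f 0 * (g 0 * h (suc n) ℚ.+ (divX g ⊛ h) n) ℚ.+ (divX f ⊛ (g ⊛ h)) n
    ≡⟨ cong (λ x → f 0 * x ℚ.+ (divX f ⊛ (g ⊛ h)) n) (⊛-suc g h n) ⟨
  f 0 * (g ⊛ h) (suc n) ℚ.+ (divX f ⊛ (g ⊛ h)) n
    ≡⟨ ⊛-suc f (g ⊛ h) n ⟨
  (f ⊛ (g ⊛ h)) (suc n) ∎
  where
  open ≡-Reasoning
  f0·g′ : FPS
  f0·g′ i = f 0 * g (suc i)
  scaled-⊛ : ∀ n → (f0·g′ ⊛ h) n ≡ f 0 * (divX g ⊛ h) n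
  scaled-⊛ n = trans (sumBelow-cong (suc n) (λ i _ → ℚ.*-assoc (f 0) (g (suc i)) (h (n ∸ i))))
                     (sumBelow-*ˡ (suc n) (f 0) _)
  regroup : ∀ a b c e r → a * b * c ℚ.+ (a * e ℚ.+ r) ≡ a * (b * c ℚ.+ e) ℚ.+ r
  regroup = solve 5 (λ a b c e r → a :* b :* c :+ (a :* e :+ r) := a :* (b :* c :+ e) :+ r) refl
    where open +-*-Solver

-- The ring of power series

⊝_ : FPS → FPS
(⊝ f) n = - f n

const-0ℚ : ∀ n → const 0ℚ n ≡ 0ℚ
const-0ℚ zero    = refl
const-0ℚ (suc n) = refl

FPS-isCommutativeRing : IsCommutativeRing _≈_ _⊕_ _⊛_ ⊝_ (const 0ℚ) (const 1ℚ)
FPS-isCommutativeRing = record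
  { isRing = record
    { +-isAbelianGroup = record
      { isGroup = record
        { isMonoid = record
          { isSemigroup = record
            { isMagma = record
              { isEquivalence = record
                { refl = λ _ → refl ; sym = λ e n → sym (e n) ; trans = λ e e′ n → trans (e n) (e′ n) }
              ; ∙-cong = λ e e′ n → cong₂ ℚ._+_ (e n) (e′ n) }
            ; assoc = λ f g h n → ℚ.+-assoc (f n) (g n) (h n) }
          ; identity = (λ f n → trans (cong (ℚ._+ f n) (const-0ℚ n)) (ℚ.+-identityˡ (f n)))
                     , (λ f n → trans (cong (f n ℚ.+_) (const-0ℚ n)) (ℚ.+-identityʳ (f n))) }
        ; inverse = (λ f n → trans (ℚ.+-inverseˡ (f n)) (sym (const-0ℚ n)))
                  , (λ f n → trans (ℚ.+-inverseʳ (f n)) (sym (const-0ℚ n)))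
        ; ⁻¹-cong = λ e n → cong -_ (e n) }
      ; comm = λ f g n → ℚ.+-comm (f n) (g n) }
    ; *-cong = ⊛-cong
    ; *-assoc = ⊛-assoc
    ; *-identity = (λ f n → trans (const-⊛ˡ 1ℚ f n) (ℚ.*-identityˡ (f n)))
                 , (λ f n → trans (⊛-comm f (const 1ℚ) n) (trans (const-⊛ˡ 1ℚ f n) (ℚ.*-identityˡ (f n))))
    ; distrib = (λ h f g n → trans (⊛-comm h (f ⊕ g) n)
                               (trans (⊛-distribʳ-⊕ f g h n) (cong₂ ℚ._+_ (⊛-comm f h n) (⊛-comm g h n))))
              , (λ h f g → ⊛-distribʳ-⊕ f g h) }
  ; *-comm = ⊛-comm }

FPS-commutativeRing : CommutativeRing _ _
FPS-commutativeRing = record { isCommutativeRing = FPS-isCommutativeRing }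

module 𝔽 = CommutativeRing FPS-commutativeRing
module 𝔽-Properties = Algebra.Properties.Ring 𝔽.ring

const-cong : ∀ {p r} → p ≡ r → const p ≈ const r
const-cong p≡r n = cong (λ c → const c n) p≡r

const-⊕ : ∀ p r → (const p ⊕ const r) ≈ const (p ℚ.+ r)
const-⊕ p r zero    = refl
const-⊕ p r (suc n) = refl

const-⊛ : ∀ p r → (const p ⊛ const r) ≈ const (p * r)
const-⊛ p r zero    = const-⊛ˡ p (const r) zero
const-⊛ p r (suc n) = trans (const-⊛ˡ p (const r) (suc n)) (ℚ.*-zeroʳ p)

const-homomorphism :
  CommutativeRing.rawRing ℚ.+-*-commutativeRing -Raw-AlmostCommutative⟶ fromCommutativeRing FPS-commutativeRing
const-homomorphism = record
  { ⟦_⟧    = const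
  ; +-homo = λ p r → 𝔽.sym (const-⊕ p r)
  ; *-homo = λ p r → 𝔽.sym (const-⊛ p r)
  ; -‿homo = λ p → λ { zero → refl ; (suc n) → refl }
  ; 0-homo = λ { zero → refl ; (suc n) → refl }
  ; 1-homo = λ { zero → refl ; (suc n) → refl } }

const-≟ : ∀ p q → Maybe (const p ≈ const q)
const-≟ p q with p ℚ.≟ q
... | yes p≡q = just (const-cong p≡q)
... | no  _   = nothing

module FPS-Solver = Algebra.Solver.Ring
  (CommutativeRing.rawRing ℚ.+-*-commutativeRing) (fromCommutativeRing FPS-commutativeRing)
  const-homomorphism const-≟

-- Inverses and square roots

-- seqFrom computes coefficient n+1 from a table that agrees with seqFrom only up to
-- index n, so the recursion step must not look beyond it.
Causal : (ℕ → (ℕ → ℚ) → ℚ) → Set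
Causal step = ∀ n h h′ → (∀ k → k ℕ.≤ n → h k ≡ h′ k) → step n h ≡ step n h′

module _ (c : ℚ) (step : ℕ → (ℕ → ℚ) → ℚ) where

  private
    cov-suc-top : ∀ n → cov c step (suc n) (suc n) ≡ step n (cov c step n)
    cov-suc-top n with suc n ≤? n
    ... | yes 1+n≤n = ⊥-elim (ℕ.n≮n n 1+n≤n)
    ... | no  _     = refl

    cov-stable : ∀ n k → k ℕ.≤ n → cov c step n k ≡ seqFrom c step k
    cov-stable zero    zero z≤n = refl
    cov-stable (suc n) k k≤1+n with k ≤? n
    ... | yes k≤n = cov-stable n k k≤n
    ... | no  k≰n = sym (trans (cong (λ j → cov c step j j) (ℕ.≤-antisym k≤1+n (ℕ.≰⇒> k≰n)))
                               (cov-suc-top n))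

  seqFrom-suc : Causal step → ∀ n → seqFrom c step (suc n) ≡ step n (seqFrom c step)
  seqFrom-suc causal n = trans (cov-suc-top n) (causal n _ _ (cov-stable n))

*-÷′-inverse : ∀ {q} → q ≢ 0ℚ → q * (1ℚ ÷′ q) ≡ 1ℚ
*-÷′-inverse {q} q≢0 with q ℚ.≟ 0ℚ
... | yes q≡0 = ⊥-elim (q≢0 q≡0)
... | no  q≢0′ = trans (cong (q *_) (ℚ.*-identityˡ _)) (ℚ.*-inverseʳ q {{ℚ.≢-nonZero q≢0′}})

⊛-inv : ∀ f → f 0 ≢ 0ℚ → (f ⊛ inv f) ≈ const 1ℚ
⊛-inv f f₀≢0 zero    = trans (⊛-head f (inv f)) (*-÷′-inverse f₀≢0)
⊛-inv f f₀≢0 (suc n) = begin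
  (f ⊛ inv f) (suc n)                    ≡⟨ ⊛-suc f (inv f) n ⟩
  f 0 * inv f (suc n) ℚ.+ s              ≡⟨ cong (λ x → f 0 * x ℚ.+ s) (seqFrom-suc _ _ causal n) ⟩
  f 0 * - (1ℚ ÷′ f 0 * s) ℚ.+ s          ≡⟨ ℚ-lemma (f 0) (1ℚ ÷′ f 0) s ⟩
  - (f 0 * (1ℚ ÷′ f 0) * s) ℚ.+ s        ≡⟨ cong (λ x → - (x * s) ℚ.+ s) (*-÷′-inverse f₀≢0) ⟩
  - (1ℚ * s) ℚ.+ s                       ≡⟨ trans (cong (λ x → - x ℚ.+ s) (ℚ.*-identityˡ s)) (ℚ.+-inverseˡ s) ⟩
  0ℚ                                     ∎
  where
  open ≡-Reasoning
  s = (divX f ⊛ inv f) n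
  causal : Causal (λ n h → - ((1ℚ ÷′ f 0) * sumBelow (suc n) (λ j → f (suc j) * h (n ∸ j))))
  causal n h h′ h≡h′ = cong (λ x → - ((1ℚ ÷′ f 0) * x))
    (sumBelow-cong (suc n) (λ j _ → cong (f (suc j) *_) (h≡h′ (n ∸ j) (ℕ.m∸n≤m n j))))
  ℚ-lemma : ∀ a b s → a * - (b * s) ℚ.+ s ≡ - (a * b * s) ℚ.+ s
  ℚ-lemma = solve 3 (λ a b s → a :* :- (b :* s) :+ s := :- (a :* b :* s) :+ s) refl
    where open +-*-Solver

⊛-cancelˡ : ∀ w {g h} → w 0 ≢ 0ℚ → (w ⊛ g) ≈ (w ⊛ h) → g ≈ h
⊛-cancelˡ w {g} {h} w₀≢0 wg≈wh = begin
  g                     ≈⟨ 𝔽.*-identityˡ g ⟨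
  const 1ℚ ⊛ g          ≈⟨ 𝔽.*-congʳ {g} w⁻¹w≈1 ⟨
  inv w ⊛ w ⊛ g         ≈⟨ 𝔽.*-assoc (inv w) w g ⟩
  inv w ⊛ (w ⊛ g)       ≈⟨ 𝔽.*-congˡ {inv w} wg≈wh ⟩
  inv w ⊛ (w ⊛ h)       ≈⟨ 𝔽.*-assoc (inv w) w h ⟨
  inv w ⊛ w ⊛ h         ≈⟨ 𝔽.*-congʳ {h} w⁻¹w≈1 ⟩
  const 1ℚ ⊛ h          ≈⟨ 𝔽.*-identityˡ h ⟩
  h                     ∎
  where
  open Relation.Binary.Reasoning.Setoid 𝔽.setoid
  w⁻¹w≈1 : (inv w ⊛ w) ≈ const 1ℚ
  w⁻¹w≈1 = 𝔽.trans (𝔽.*-comm (inv w) w) (⊛-inv w w₀≢0)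

⊛-⊘-cancel : ∀ f g → g 0 ≢ 0ℚ → (g ⊛ (f ⊘ g)) ≈ f
⊛-⊘-cancel f g g₀≢0 = begin
  g ⊛ (f ⊛ inv g)     ≈⟨ FPS-Solver.solve 3 (λ f g g⁻¹ → g :* (f :* g⁻¹) := f :* (g :* g⁻¹)) 𝔽.refl f g (inv g) ⟩
  f ⊛ (g ⊛ inv g)     ≈⟨ 𝔽.*-congˡ {f} (⊛-inv g g₀≢0) ⟩
  f ⊛ const 1ℚ        ≈⟨ 𝔽.*-identityʳ f ⟩
  f                   ∎
  where
  open Relation.Binary.Reasoning.Setoid 𝔽.setoid
  open FPS-Solver using (_:*_; _:=_)

g⊛h≈f⇒h≈f⊘g : ∀ {f g h} → g 0 ≢ 0ℚ → (g ⊛ h) ≈ f → h ≈ (f ⊘ g)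
g⊛h≈f⇒h≈f⊘g {f} {g} g₀≢0 gh≈f = ⊛-cancelˡ g g₀≢0 (𝔽.trans gh≈f (𝔽.sym (⊛-⊘-cancel f g g₀≢0)))

½ : ℚ
½ = 1ℚ ÷′ ι (+ 2)

sqrt⊛sqrt : ∀ f → f 0 ≡ 1ℚ → (sqrt f ⊛ sqrt f) ≈ f
sqrt⊛sqrt f f₀≡1 zero    = sym f₀≡1
sqrt⊛sqrt f f₀≡1 (suc n) = begin
  (s ⊛ s) (suc n)                                ≡⟨ ⊛-suc s s n ⟩
  1ℚ * s (suc n) ℚ.+ (Σ ℚ.+ s (suc n) * s (n ∸ n))
    ≡⟨ cong₂ (λ x k → 1ℚ * x ℚ.+ (Σ ℚ.+ x * s k)) (seqFrom-suc _ _ causal n) (ℕ.n∸n≡0 n) ⟩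
  1ℚ * ((f (suc n) - Σ) * ½) ℚ.+ (Σ ℚ.+ (f (suc n) - Σ) * ½ * 1ℚ)
    ≡⟨ ℚ-lemma (f (suc n)) Σ ⟩
  f (suc n)                                       ∎
  where
  open ≡-Reasoning
  s = sqrt f
  Σ = sumBelow n (λ j → s (suc j) * s (n ∸ j))
  causal : Causal (λ n h → (f (suc n) - sumBelow n (λ j → h (suc j) * h (n ∸ j))) ÷′ ι (+ 2))
  causal n h h′ h≡h′ = cong (λ x → (f (suc n) - x) ÷′ ι (+ 2))
    (sumBelow-cong n (λ j j<n → cong₂ _*_ (h≡h′ (suc j) j<n) (h≡h′ (n ∸ j) (ℕ.m∸n≤m n j))))
  ℚ-lemma : ∀ a Σ → 1ℚ * ((a - Σ) * ½) ℚ.+ (Σ ℚ.+ (a - Σ) * ½ * 1ℚ) ≡ a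
  ℚ-lemma = solve 2 (λ a Σ → con 1ℚ :* ((a :- Σ) :* con ½) :+ (Σ :+ (a :- Σ) :* con ½ :* con 1ℚ) := a) refl
    where open +-*-Solver

sqrt-unique : ∀ f g → g 0 ≡ 1ℚ → (g ⊛ g) ≈ f → g ≈ sqrt f
sqrt-unique f g g₀≡1 g²≈f = 𝔽-Properties.x∙y⁻¹≈ε⇒x≈y g s (⊛-cancelˡ (g ⊕ s) [g+s]₀≢0 (begin
  (g ⊕ s) ⊛ (g ⊖ s)          ≈⟨ FPS-Solver.solve 2 (λ g s → (g :+ s) :* (g :- s) := g :* g :- s :* s) 𝔽.refl g s ⟩
  g ⊛ g ⊖ s ⊛ s              ≈⟨ 𝔽.+-cong g²≈f (𝔽.-‿cong (sqrt⊛sqrt f f₀≡1)) ⟩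
  f ⊖ f                      ≈⟨ 𝔽.-‿inverseʳ f ⟩
  const 0ℚ                   ≈⟨ 𝔽.zeroʳ (g ⊕ s) ⟨
  (g ⊕ s) ⊛ const 0ℚ         ∎))
  where
  open Relation.Binary.Reasoning.Setoid 𝔽.setoid
  open FPS-Solver using (_:+_; _:*_; _:-_; _:=_)
  s = sqrt f
  f₀≡1 : f 0 ≡ 1ℚ
  f₀≡1 = trans (sym (g²≈f 0)) (trans (⊛-head g g) (cong₂ _*_ g₀≡1 g₀≡1))
  [g+s]₀≢0 : (g ⊕ s) 0 ≢ 0ℚ
  [g+s]₀≢0 [g+s]₀≡0 with trans (sym (cong (ℚ._+ 1ℚ) g₀≡1)) [g+s]₀≡0
  ... | ()

X⊛-head : ∀ f → (X ⊛ f) 0 ≡ 0ℚ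
X⊛-head f = trans (⊛-head X f) (ℚ.*-zeroˡ (f 0))

X⊛-suc : ∀ f n → (X ⊛ f) (suc n) ≡ f n
X⊛-suc f n = begin
  (X ⊛ f) (suc n)                     ≡⟨ ⊛-suc X f n ⟩
  0ℚ * f (suc n) ℚ.+ (divX X ⊛ f) n   ≡⟨ cong₂ ℚ._+_ (ℚ.*-zeroˡ (f (suc n))) (⊛-cong {g = f} divX-X (λ _ → refl) n) ⟩
  0ℚ ℚ.+ (const 1ℚ ⊛ f) n             ≡⟨ ℚ.+-identityˡ _ ⟩
  (const 1ℚ ⊛ f) n                    ≡⟨ 𝔽.*-identityˡ f n ⟩
  f n                                 ∎
  where
  open ≡-Reasoning
  divX-X : divX X ≈ const 1ℚ
  divX-X zero    = refl
  divX-X (suc i) = refl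

X⊛-cancelˡ : ∀ {f g} → (X ⊛ f) ≈ (X ⊛ g) → f ≈ g
X⊛-cancelˡ {f} {g} Xf≈Xg n = trans (sym (X⊛-suc f n)) (trans (Xf≈Xg (suc n)) (X⊛-suc g n))

X⊛divX : ∀ f → f 0 ≡ 0ℚ → (X ⊛ divX f) ≈ f
X⊛divX f f₀≡0 zero    = trans (X⊛-head (divX f)) (sym f₀≡0)
X⊛divX f f₀≡0 (suc n) = X⊛-suc (divX f) n

1⊖X⊛-head≢0 : ∀ f → (const 1ℚ ⊖ X ⊛ f) 0 ≢ 0ℚ
1⊖X⊛-head≢0 f head≡0 with trans (sym (cong (λ x → 1ℚ - x) (X⊛-head f))) head≡0
... | ()

-- The numbers dₘ

÷′-as-* : ∀ p {q} → q ≢ 0ℚ → p ÷′ q ≡ p * (1ℚ ÷′ q)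
÷′-as-* p {q} q≢0 with q ℚ.≟ 0ℚ
... | yes q≡0 = ⊥-elim (q≢0 q≡0)
... | no  _   = cong (p *_) (sym (ℚ.*-identityˡ _))

*-÷′-cancelʳ : ∀ p {q} → q ≢ 0ℚ → p * q * (1ℚ ÷′ q) ≡ p
*-÷′-cancelʳ p {q} q≢0 =
  trans (ℚ.*-assoc p q _) (trans (cong (p *_) (*-÷′-inverse q≢0)) (ℚ.*-identityʳ p))

÷′-*-cancelʳ : ∀ p {q} → q ≢ 0ℚ → (p ÷′ q) * q ≡ p
÷′-*-cancelʳ p {q} q≢0 = begin
  (p ÷′ q) * q               ≡⟨ cong (_* q) (÷′-as-* p q≢0) ⟩
  p * (1ℚ ÷′ q) * q          ≡⟨ ℚ.*-assoc p _ q ⟩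
  p * ((1ℚ ÷′ q) * q)        ≡⟨ cong (p *_) (trans (ℚ.*-comm _ q) (*-÷′-inverse q≢0)) ⟩
  p * 1ℚ                     ≡⟨ ℚ.*-identityʳ p ⟩
  p                          ∎
  where open ≡-Reasoning

*-cancelʳ-≢0 : ∀ {p q r} → r ≢ 0ℚ → p * r ≡ q * r → p ≡ q
*-cancelʳ-≢0 {p} {q} {r} r≢0 pr≡qr =
  trans (sym (*-÷′-cancelʳ p r≢0)) (trans (cong (_* (1ℚ ÷′ r)) pr≡qr) (*-÷′-cancelʳ q r≢0))

ι-mkℚ : ∀ m → ι (+ m) ≡ ℚ.mkℚ (+ m) 0 (Coprimality.sym (Coprimality.1-coprimeTo m))
ι-mkℚ m = ℚ.normalize-coprime (Coprimality.sym (Coprimality.1-coprimeTo m))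

ι-+ : ∀ m n → ι (+ m) ℚ.+ ι (+ n) ≡ ι (+ (m ℕ.+ n))
ι-+ m n = trans (cong₂ ℚ._+_ (ι-mkℚ m) (ι-mkℚ n))
                (cong (ℚ._/ 1) (cong₂ ℤ._+_ (ℤ.*-identityʳ (+ m)) (ℤ.*-identityʳ (+ n))))

ι-* : ∀ m n → ι (+ m) * ι (+ n) ≡ ι (+ (m ℕ.* n))
ι-* m n = trans (cong₂ _*_ (ι-mkℚ m) (ι-mkℚ n)) (cong (ℚ._/ 1) (sym (ℤ.pos-* m n)))

ι≢0 : ∀ {m} → 0 < m → ι (+ m) ≢ 0ℚ
ι≢0 {suc m} _ ι≡0 with trans (sym (ι-mkℚ (suc m))) ι≡0
... | ()

-- fibOdd n = F₂ₙ₋₁ (so fibOdd 0 = F₋₁ = 1) and d₂ₙ₊₁ = fibOdd (n + 1) / fibOdd n.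
fibOdd : ℕ → ℕ
fibOdd zero    = 1
fibOdd (suc n) = fib (2 ℕ.* n ℕ.+ 1)

2[1+n]+1≡2+[2n+1] : ∀ n → 2 ℕ.* suc n ℕ.+ 1 ≡ 2 ℕ.+ (2 ℕ.* n ℕ.+ 1)
2[1+n]+1≡2+[2n+1] n = cong (ℕ._+ 1) (ℕ.*-suc 2 n)

fib-pos : ∀ k → 0 < fib (suc k)
fib-pos zero    = ℕ.z<s
fib-pos (suc k) = ℕ.≤-trans (fib-pos k) (ℕ.m≤m+n (fib (suc k)) (fib k))

fibOdd-pos : ∀ n → 0 < fibOdd n
fibOdd-pos zero    = ℕ.z<s
fibOdd-pos (suc n) = subst (λ k → 0 < fib k) (ℕ.+-comm 1 (2 ℕ.* n)) (fib-pos (2 ℕ.* n))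

fib[4+k]+fib[k]≡3*fib[2+k] : ∀ k → fib (4 ℕ.+ k) ℕ.+ fib k ≡ 3 ℕ.* fib (2 ℕ.+ k)
fib[4+k]+fib[k]≡3*fib[2+k] k =
  solve 2 (λ a b → ((a :+ b) :+ a) :+ (a :+ b) :+ b := con 3 :* (a :+ b)) refl (fib (suc k)) (fib k)
  where open Data.Nat.Solver.+-*-Solver

fibOdd-recurrence : ∀ n → fibOdd (2 ℕ.+ n) ℕ.+ fibOdd n ≡ 3 ℕ.* fibOdd (suc n)
fibOdd-recurrence zero    = refl
fibOdd-recurrence (suc n) = begin
  fib (2 ℕ.* suc (suc n) ℕ.+ 1) ℕ.+ fib (2 ℕ.* n ℕ.+ 1)
    ≡⟨ cong (λ k → fib k ℕ.+ fib (2 ℕ.* n ℕ.+ 1))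
            (trans (2[1+n]+1≡2+[2n+1] (suc n)) (cong (2 ℕ.+_) (2[1+n]+1≡2+[2n+1] n))) ⟩
  fib (4 ℕ.+ (2 ℕ.* n ℕ.+ 1)) ℕ.+ fib (2 ℕ.* n ℕ.+ 1)
    ≡⟨ fib[4+k]+fib[k]≡3*fib[2+k] (2 ℕ.* n ℕ.+ 1) ⟩
  3 ℕ.* fib (2 ℕ.+ (2 ℕ.* n ℕ.+ 1))
    ≡⟨ cong (λ k → 3 ℕ.* fib k) (2[1+n]+1≡2+[2n+1] n) ⟨
  3 ℕ.* fib (2 ℕ.* suc n ℕ.+ 1) ∎
  where open ≡-Reasoning

dodd≡fibOdd÷′fibOdd : ∀ n → dodd n ≡ ι (+ fibOdd (suc n)) ÷′ ι (+ fibOdd n)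
dodd≡fibOdd÷′fibOdd zero    = refl
dodd≡fibOdd÷′fibOdd (suc n) =
  cong (λ k → ι (+ fibOdd (suc (suc n))) ÷′ ι (fibℤ (+ k ℤ.- + 2))) (2[1+n]+1≡2+[2n+1] n)

module _ (n : ℕ) where

  private
    p r t : ℚ
    p = ι (+ fibOdd n)
    r = ι (+ fibOdd (suc n))
    t = ι (+ fibOdd (2 ℕ.+ n))

    p≢0 : p ≢ 0ℚ
    p≢0 = ι≢0 (fibOdd-pos n)

    r≢0 : r ≢ 0ℚ
    r≢0 = ι≢0 (fibOdd-pos (suc n))

    dodd*p≡r : dodd n * p ≡ r
    dodd*p≡r = trans (cong (_* p) (dodd≡fibOdd÷′fibOdd n)) (÷′-*-cancelʳ r p≢0)

  dodd≢0 : dodd n ≢ 0ℚ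
  dodd≢0 dodd≡0 = r≢0
    (trans (sym dodd*p≡r) (trans (cong (_* p) dodd≡0) (ℚ.*-zeroˡ p)))

  dodd*deven≡1 : dodd n * deven (suc n) ≡ 1ℚ
  dodd*deven≡1 = *-÷′-inverse dodd≢0

  dodd+deven≡3 : dodd (suc n) ℚ.+ deven (suc n) ≡ ι (+ 3)
  dodd+deven≡3 = *-cancelʳ-≢0 r≢0 (begin
    (e ℚ.+ b) * r                            ≡⟨ ℚ.*-distribʳ-+ r e b ⟩
    e * r ℚ.+ b * r                          ≡⟨ cong₂ ℚ._+_ e*r≡t b*r≡p ⟩
    t ℚ.+ p                                  ≡⟨ ι-+ (fibOdd (2 ℕ.+ n)) (fibOdd n) ⟩
    ι (+ (fibOdd (2 ℕ.+ n) ℕ.+ fibOdd n))    ≡⟨ cong (λ k → ι (+ k)) (fibOdd-recurrence n) ⟩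
    ι (+ (3 ℕ.* fibOdd (suc n)))             ≡⟨ ι-* 3 (fibOdd (suc n)) ⟨
    ι (+ 3) * r                              ∎)
    where
    open ≡-Reasoning
    e = dodd (suc n)
    b = deven (suc n)
    e*r≡t : e * r ≡ t
    e*r≡t = trans (cong (_* r) (dodd≡fibOdd÷′fibOdd (suc n))) (÷′-*-cancelʳ t r≢0)
    b*r≡p : b * r ≡ p
    b*r≡p = begin
      b * r                 ≡⟨ cong (b *_) dodd*p≡r ⟨
      b * (dodd n * p)      ≡⟨ ℚ.*-assoc b (dodd n) p ⟨
      b * dodd n * p        ≡⟨ cong (_* p) (trans (ℚ.*-comm b (dodd n)) dodd*deven≡1) ⟩
      1ℚ * p                ≡⟨ ℚ.*-identityˡ p ⟩
      p                     ∎

ContinuedFraction : FPS → ℚ → FPS → Set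
ContinuedFraction f c g = f ≈ (const c ⊘ (const 1ℚ ⊖ X ⊛ g))

ContinuedFraction-subst : ∀ {f f′ c c′ g g′} → f ≡ f′ → c ≡ c′ → g ≡ g′ →
                          ContinuedFraction f′ c′ g′ → ContinuedFraction f c g
ContinuedFraction-subst refl refl refl cf = cf

continued-fraction-step : ∀ {y c b E} → E 0 ≢ 0ℚ →
  ((E ⊖ X ⊛ b) ⊛ y) ≈ (const c ⊛ E) → ContinuedFraction y c (b ⊘ E)
continued-fraction-step {y} {c} {b} {E} E₀≢0 [E-Xb]y≈cE =
  g⊛h≈f⇒h≈f⊘g {const c} {const 1ℚ ⊖ X ⊛ (b ⊘ E)} (1⊖X⊛-head≢0 (b ⊘ E)) (⊛-cancelˡ E E₀≢0 (begin
    E ⊛ ((const 1ℚ ⊖ X ⊛ (b ⊘ E)) ⊛ y)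
      ≈⟨ FPS-Solver.solve 4 (λ E X q y → E :* ((con 1ℚ :- X :* q) :* y) := (E :- X :* (E :* q)) :* y)
                           𝔽.refl E X (b ⊘ E) y ⟩
    (E ⊖ X ⊛ (E ⊛ (b ⊘ E))) ⊛ y
      ≈⟨ 𝔽.*-congʳ {y} (𝔽.+-congˡ {E} (𝔽.-‿cong (𝔽.*-congˡ {X} (⊛-⊘-cancel b E E₀≢0)))) ⟩
    (E ⊖ X ⊛ b) ⊛ y
      ≈⟨ [E-Xb]y≈cE ⟩
    const c ⊛ E
      ≈⟨ 𝔽.*-comm (const c) E ⟩
    E ⊛ const c ∎))
  where
  open Relation.Binary.Reasoning.Setoid 𝔽.setoid
  open FPS-Solver using (_:*_; _:-_; _:=_; con)

-- The series Rₘ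

¼ : ℚ
¼ = 1ℚ ÷′ ι (+ 4)

S T : FPS
S = sqrt ((const 1ℚ ⊖ X) ⊛ (const 1ℚ ⊖ const (ι (+ 5)) ⊛ X))
T = sqrt ((const 1ℚ ⊖ const (ι (+ 5)) ⊛ X) ⊘ (const 1ℚ ⊖ X))

X⊛C : (X ⊛ C) ≈ ((const 1ℚ ⊖ const (ι (+ 3)) ⊛ X ⊖ S) ⊛ const ½)
X⊛C = X⊛divX _ refl

C-quadratic : (X ⊛ C ⊛ C ⊖ (const 1ℚ ⊖ const (ι (+ 3)) ⊛ X) ⊛ C ⊕ X) ≈ const 0ℚ
C-quadratic = X⊛-cancelˡ (begin
  X ⊛ (X ⊛ C ⊛ C ⊖ L ⊛ C ⊕ X)
    ≈⟨ FPS-Solver.solve 3 (λ X C S →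
         X :* (X :* C :* C :- L′ X :* C :+ X)
         := (N′ X S :* con ½ :+ X :* C :- L′ X) :* (X :* C :- N′ X S :* con ½)
            :+ con ¼ :* (S :* S :- (con 1ℚ :- X) :* (con 1ℚ :- con (ι (+ 5)) :* X)))
         𝔽.refl X C S ⟩
  (N ⊛ const ½ ⊕ X ⊛ C ⊖ L) ⊛ (X ⊛ C ⊖ N ⊛ const ½) ⊕ const ¼ ⊛ (S ⊛ S ⊖ A)
    ≈⟨ 𝔽.+-cong (𝔽.*-congˡ {N ⊛ const ½ ⊕ X ⊛ C ⊖ L} (𝔽-Properties.x≈y⇒x∙y⁻¹≈ε X⊛C))
                (𝔽.*-congˡ {const ¼} (𝔽-Properties.x≈y⇒x∙y⁻¹≈ε (sqrt⊛sqrt A refl))) ⟩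
  (N ⊛ const ½ ⊕ X ⊛ C ⊖ L) ⊛ const 0ℚ ⊕ const ¼ ⊛ const 0ℚ
    ≈⟨ FPS-Solver.solve 2 (λ u X → u :* con 0ℚ :+ con ¼ :* con 0ℚ := X :* con 0ℚ)
         𝔽.refl (N ⊛ const ½ ⊕ X ⊛ C ⊖ L) X ⟩
  X ⊛ const 0ℚ ∎)
  where
  open Relation.Binary.Reasoning.Setoid 𝔽.setoid
  open FPS-Solver using (Polynomial; _:+_; _:*_; _:-_; _:=_; con)
  L N A : FPS
  L = const 1ℚ ⊖ const (ι (+ 3)) ⊛ X
  N = L ⊖ S
  A = (const 1ℚ ⊖ X) ⊛ (const 1ℚ ⊖ const (ι (+ 5)) ⊛ X)
  L′ : Polynomial 3 → Polynomial 3
  L′ X = con 1ℚ :- con (ι (+ 3)) :* X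
  N′ : Polynomial 3 → Polynomial 3 → Polynomial 3
  N′ X S = L′ X :- S

Rodd-continued-fraction : ∀ n → ContinuedFraction (Rodd n) (dodd n) (Reven (suc n))
Rodd-continued-fraction n =
  continued-fraction-step {Rodd n} {a} {const b} {E} (1⊖X⊛-head≢0 (Rodd (suc n))) (begin
    (E ⊖ X ⊛ const b) ⊛ (const a ⊕ C)
      ≈⟨ FPS-Solver.solve 5 (λ X C a b e →
           (con 1ℚ :- X :* (e :+ C) :- X :* b) :* (a :+ C)
           := a :* (con 1ℚ :- X :* (e :+ C))
              :- (X :* C :* C :- (con 1ℚ :- con (ι (+ 3)) :* X) :* C :+ X)
              :- X :* C :* (e :+ b :- con (ι (+ 3)))
              :- X :* (a :* b :- con 1ℚ))
           𝔽.refl X C (const a) (const b) (const e) ⟩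
    const a ⊛ E ⊖ Q ⊖ X ⊛ C ⊛ (const e ⊕ const b ⊖ const (ι (+ 3))) ⊖ X ⊛ (const a ⊛ const b ⊖ const 1ℚ)
      ≈⟨ 𝔽.+-cong (𝔽.+-cong (𝔽.+-congˡ {const a ⊛ E} (𝔽.-‿cong C-quadratic))
                            (𝔽.-‿cong (𝔽.*-congˡ {X ⊛ C} (𝔽-Properties.x≈y⇒x∙y⁻¹≈ε e+b≈3))))
                  (𝔽.-‿cong (𝔽.*-congˡ {X} (𝔽-Properties.x≈y⇒x∙y⁻¹≈ε ab≈1))) ⟩
    const a ⊛ E ⊖ const 0ℚ ⊖ X ⊛ C ⊛ const 0ℚ ⊖ X ⊛ const 0ℚ
      ≈⟨ FPS-Solver.solve 3 (λ X C aE → aE :- con 0ℚ :- X :* C :* con 0ℚ :- X :* con 0ℚ := aE)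
           𝔽.refl X C (const a ⊛ E) ⟩
    const a ⊛ E ∎)
  where
  open Relation.Binary.Reasoning.Setoid 𝔽.setoid
  open FPS-Solver using (_:+_; _:*_; _:-_; _:=_; con)
  a b e : ℚ
  a = dodd n
  b = deven (suc n)
  e = dodd (suc n)
  E Q : FPS
  E = const 1ℚ ⊖ X ⊛ Rodd (suc n)
  Q = X ⊛ C ⊛ C ⊖ (const 1ℚ ⊖ const (ι (+ 3)) ⊛ X) ⊛ C ⊕ X
  e+b≈3 : (const e ⊕ const b) ≈ const (ι (+ 3))
  e+b≈3 = 𝔽.trans (const-⊕ e b) (const-cong (dodd+deven≡3 n))
  ab≈1 : (const a ⊛ const b) ≈ const 1ℚ
  ab≈1 = 𝔽.trans (const-⊛ a b) (const-cong (dodd*deven≡1 n))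

[1⊖X]⊛T≈S : ((const 1ℚ ⊖ X) ⊛ T) ≈ S
[1⊖X]⊛T≈S = sqrt-unique _ ((const 1ℚ ⊖ X) ⊛ T) refl (begin
  (L ⊛ T) ⊛ (L ⊛ T)      ≈⟨ FPS-Solver.solve 2 (λ L T → (L :* T) :* (L :* T) := L :* (L :* (T :* T))) 𝔽.refl L T ⟩
  L ⊛ (L ⊛ (T ⊛ T))      ≈⟨ 𝔽.*-congˡ {L} (𝔽.*-congˡ {L} (sqrt⊛sqrt (M ⊘ L) refl)) ⟩
  L ⊛ (L ⊛ (M ⊘ L))      ≈⟨ 𝔽.*-congˡ {L} (⊛-⊘-cancel M L (λ ())) ⟩
  L ⊛ M                  ∎)
  where
  open Relation.Binary.Reasoning.Setoid 𝔽.setoid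
  open FPS-Solver using (_:*_; _:=_)
  L M : FPS
  L = const 1ℚ ⊖ X
  M = const 1ℚ ⊖ const (ι (+ 5)) ⊛ X

S⊛T≈1⊖5X : (S ⊛ T) ≈ (const 1ℚ ⊖ const (ι (+ 5)) ⊛ X)
S⊛T≈1⊖5X = begin
  S ⊛ T                  ≈⟨ 𝔽.*-congʳ {T} (𝔽.sym [1⊖X]⊛T≈S) ⟩
  (L ⊛ T) ⊛ T            ≈⟨ 𝔽.*-assoc L T T ⟩
  L ⊛ (T ⊛ T)            ≈⟨ 𝔽.*-congˡ {L} (sqrt⊛sqrt (M ⊘ L) refl) ⟩
  L ⊛ (M ⊘ L)            ≈⟨ ⊛-⊘-cancel M L (λ ()) ⟩
  M                      ∎
  where
  open Relation.Binary.Reasoning.Setoid 𝔽.setoid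
  L M : FPS
  L = const 1ℚ ⊖ X
  M = const 1ℚ ⊖ const (ι (+ 5)) ⊛ X

Rm1-continued-fraction : ContinuedFraction Rm1 1ℚ (Reven 0)
Rm1-continued-fraction =
  continued-fraction-step {Rm1} {1ℚ} {const 1ℚ} {E} (1⊖X⊛-head≢0 (Rodd 0)) (begin
    (E ⊖ X ⊛ const 1ℚ) ⊛ Rm1
      ≈⟨ FPS-Solver.solve 4 (λ X C S T →
           (con 1ℚ :- X :* (con 1ℚ :+ C) :- X :* con 1ℚ) :* (con (ι (+ 3) ÷′ ι (+ 2)) :- con ½ :* T)
           := con 1ℚ :* (con 1ℚ :- X :* (con 1ℚ :+ C))
              :+ (con ½ :* T :- con ½) :* (X :* C :- (con 1ℚ :- con (ι (+ 3)) :* X :- S) :* con ½)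
              :+ con ¼ :* ((S :- (con 1ℚ :- X) :* T) :- (S :* T :- (con 1ℚ :- con (ι (+ 5)) :* X))))
           𝔽.refl X C S T ⟩
    const 1ℚ ⊛ E ⊕ (const ½ ⊛ T ⊖ const ½) ⊛ (X ⊛ C ⊖ N ⊛ const ½) ⊕ const ¼ ⊛ ((S ⊖ L ⊛ T) ⊖ (S ⊛ T ⊖ M))
      ≈⟨ 𝔽.+-cong (𝔽.+-congˡ {const 1ℚ ⊛ E} (𝔽.*-congˡ {const ½ ⊛ T ⊖ const ½} (𝔽-Properties.x≈y⇒x∙y⁻¹≈ε X⊛C)))
                  (𝔽.*-congˡ {const ¼} (𝔽.+-cong (𝔽-Properties.x≈y⇒x∙y⁻¹≈ε (𝔽.sym [1⊖X]⊛T≈S))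
                                             (𝔽.-‿cong (𝔽-Properties.x≈y⇒x∙y⁻¹≈ε S⊛T≈1⊖5X)))) ⟩
    const 1ℚ ⊛ E ⊕ (const ½ ⊛ T ⊖ const ½) ⊛ const 0ℚ ⊕ const ¼ ⊛ (const 0ℚ ⊖ const 0ℚ)
      ≈⟨ FPS-Solver.solve 2 (λ E u → E :+ u :* con 0ℚ :+ con ¼ :* (con 0ℚ :- con 0ℚ) := E)
           𝔽.refl (const 1ℚ ⊛ E) (const ½ ⊛ T ⊖ const ½) ⟩
    const 1ℚ ⊛ E ∎)
  where
  open Relation.Binary.Reasoning.Setoid 𝔽.setoid
  open FPS-Solver using (_:+_; _:*_; _:-_; _:=_; con)
  E L M N : FPS
  E = const 1ℚ ⊖ X ⊛ Rodd 0
  L = const 1ℚ ⊖ X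
  M = const 1ℚ ⊖ const (ι (+ 5)) ⊛ X
  N = const 1ℚ ⊖ const (ι (+ 3)) ⊛ X ⊖ S

double : ℕ → ℕ
double zero    = zero
double (suc n) = suc (suc (double n))

data EvenOdd : ℕ → Set where
  even : ∀ n → EvenOdd (double n)
  odd  : ∀ n → EvenOdd (suc (double n))

evenOdd : ∀ k → EvenOdd k
evenOdd zero          = even zero
evenOdd (suc zero)    = odd zero
evenOdd (suc (suc k)) with evenOdd k
... | even n = even (suc n)
... | odd  n = odd (suc n)

isEven-double : ∀ n → isEven (double n) ≡ true
isEven-double zero    = refl
isEven-double (suc n) rewrite isEven-double n = refl

⌊double/2⌋≡ : ∀ n → ⌊ double n /2⌋ ≡ n
⌊double/2⌋≡ zero    = refl
⌊double/2⌋≡ (suc n) = cong suc (⌊double/2⌋≡ n)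

⌊1+double/2⌋≡ : ∀ n → ⌊ suc (double n) /2⌋ ≡ n
⌊1+double/2⌋≡ zero    = refl
⌊1+double/2⌋≡ (suc n) = cong suc (⌊1+double/2⌋≡ n)

isEven-suc-double : ∀ n → isEven (suc (double n)) ≡ false
isEven-suc-double n = cong (λ b → if b then false else true) (isEven-double n)

if-true : ∀ {A : Set} {b} {x y : A} → b ≡ true → (if b then x else y) ≡ x
if-true refl = refl

if-false : ∀ {A : Set} {b} {x y : A} → b ≡ false → (if b then x else y) ≡ y
if-false refl = refl

R-double : ∀ n → R (+ double n) ≡ Reven n
R-double n = trans (if-true (isEven-double n)) (cong Reven (⌊double/2⌋≡ n))

R-suc-double : ∀ n → R (+ suc (double n)) ≡ Rodd n
R-suc-double n = trans (if-false (isEven-suc-double n)) (cong Rodd (⌊1+double/2⌋≡ n))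

d-double : ∀ n → d (+ double n) ≡ deven n
d-double n = trans (if-true (isEven-double n)) (cong deven (⌊double/2⌋≡ n))

d-suc-double : ∀ n → d (+ suc (double n)) ≡ dodd n
d-suc-double n = trans (if-false (isEven-suc-double n)) (cong dodd (⌊1+double/2⌋≡ n))

R-continued-fraction : ∀ {k} → EvenOdd k → ContinuedFraction (R (+ k)) (d (+ k)) (R (+ suc k))
R-continued-fraction (even n) =
  ContinuedFraction-subst (R-double n) (d-double n) (R-suc-double n) 𝔽.refl
R-continued-fraction (odd n) =
  ContinuedFraction-subst (R-suc-double n) (d-suc-double n) (R-double (suc n)) (Rodd-continued-fraction n)

lemma2p5 : (m : ℤ) → -[1+ 0 ] ≤ m →
    R m ≈ (const (d m) ⊘ (const 1ℚ ⊖ X ⊛ R (m + + 1)))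
lemma2p5 -[1+ 0 ]     _        = Rm1-continued-fraction
lemma2p5 -[1+ suc _ ] (-≤- ())
lemma2p5 (+ k)        _        =
  ContinuedFraction-subst refl refl (cong (λ j → R (+ j)) (ℕ.+-comm k 1)) (R-continued-fraction (evenOdd k))
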